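{- Let $n\ge 2$ and consider the linear compartmental model $\mathcal{M}_n=(H,\{1\},\{n\},\emptyset)$ with no leaks, where $H=P_n\cup\{n\to n-1\}$ is the directed path $1\to 2\to\cdots\to n$ together with the edge $n\to n-1$, input in compartment $1$ and output compartment $n$. Its parameters are $Q_n=\{a_{21},a_{32},\ldots,a_{n(n-1)},a_{(n-1)n}\}$ ($a_{kj}$ the label of edge $j\to k$). Then the input-output equation of $\mathcal{M}_n$ has the form $$y_n^{(n)}+c_{n-1}y_n^{(n-1)}+\cdots+c_1y_n'=d_0u_1,$$ (i.e. $c_0=0$ and $d_1=\cdots=d_{n-1}=0$), with $$c_j=\sigma_{n-j}(Q_n)-\left(a_{n(n-1)}a_{(n-1)n}\right)\cdot\sigma_{n-j-2}\big(Q_n\setminus\{a_{n(n-1)},a_{(n-1)n}\}\big)\quad\text{for } j\in\{1,\ldots,n-1\},$$ and $d_0=a_{21}a_{32}\cdots a_{n(n-1)}$.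
   Context: A linear compartmental model $\mathcal{M}=(G,\{in\},\{out\},Leak)$ consists of a directed graph $G$ on vertices $\{1,\ldots,n\}$ with a positive parameter (label) $a_{kj}$ for each edge $j\to k$, an input compartment $in$, an output compartment $out$, and a set $Leak$ of compartments $j$ each with a leak parameter $a_{0j}$. Its compartmental matrix $A$ has $A_{jj}=-\sum_{k:\,j\to k\in E}a_{kj}$ (minus additionally $a_{0j}$ if $j\in Leak$), $A_{kj}=a_{kj}$ if $j\to k$ is an edge, and $0$ otherwise; the model is the ODE system $\dot x=Ax+u$ with $u_j=0$ for $j\ne in$ and output $y_{out}=x_{out}$. Its input-output equation is the ODE $y_{out}^{(n)}+c_{n-1}y_{out}^{(n-1)}+\cdots+c_0y_{out}=d_{n-1}u_{in}^{(n-1)}+\cdots+d_0u_{in}$ obtained by eliminating the state variables; its coefficients are given as follows. Let $\widetilde G$ be $G$ with an extra vertex $0$ and an edge $j\to 0$ labeled $a_{0j}$ for each $j\in Leak$ (so $\widetilde G=G$ if there are no leaks), and $\widetilde G^*$ be $\widetilde G$ with all edges leaving $out$ removed. An incoming forest is a set of edges whose underlying undirected graph has no cycle and in which no vertex has more than one outgoing edge; $\mathcal F_k(\cdot)$ denotes incoming forests with $k$ edges and $\mathcal F_k^{in,out}(\cdot)$ those that also contain a directed path from $in$ to $out$; the productivity $\pi_F$ is the product of the edge labels of $F$. Then $c_i=\sum_{F\in\mathcal F_{n-i}(\widetilde G)}\pi_F$ and $d_i=\sum_{F\in\mathcal F_{n-i-1}^{in,out}(\widetilde G^*)}\pi_F$.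 For a finite set of variables $Q$, $\sigma_k(Q)$ is the $k$-th elementary symmetric polynomial (sum of all products of $k$ distinct elements of $Q$), with conventions $\sigma_0(Q)=1$ and $\sigma_k(Q)=0$ for $k<0$. -}

module Defs where

open import Level using (Level)
open import Data.Bool using (Bool; true; false; if_then_else_; _∧_; _∨_; not)
open import Data.Nat using (ℕ; zero; suc; _≡ᵇ_; _≤ᵇ_; _∸_)
open import Data.Integer using (ℤ; +_; -[1+_])
open import Data.Product using (_×_; _,_)
open import Data.List using (List; []; _∷_; _++_; map; length; filterᵇ; foldr; upTo; _∷ʳ_)
open import Data.Bool.ListAction using (all; any)
open import Algebra.Bundles using (CommutativeRing)

-- Graphs.  Vertices are natural numbers: compartments are 1,…,n and the
-- extra "leak" vertex of G̃ is 0.  A directed edge j → k is the pair (j , k).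

Edge : Set
Edge = ℕ × ℕ

source : Edge → ℕ
source (j , _) = j

target : Edge → ℕ
target (_ , k) = k

record Model : Set where
  field
    size   : ℕ
    edges  : List Edge  -- edges of G (distinct), j → k written (j , k)
    inp    : ℕ
    out    : ℕ
    leaks  : List ℕ     -- the set Leak (distinct)
open Model public

edgesG̃ : Model → List Edge
edgesG̃ M = edges M ++ map (λ j → (j , 0)) (leaks M)

edgesG̃* : Model → List Edge
edgesG̃* M = filterᵇ (λ e → not (source e ≡ᵇ out M)) (edgesG̃ M)

-- Subsets of an edge set (as sublists of a duplicate-free list).

sublists : {A : Set} → List A → List (List A)
sublists []       = [] ∷ []
sublists (x ∷ xs) = map (x ∷_) (sublists xs) ++ sublists xs

-- Decided by adding the
-- edges one by one and tracking connected components (r maps a vertex to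
-- the representative of its component): a cycle appears exactly when an
-- edge joins two vertices already in the same component (this includes a
-- pair of antiparallel edges j → k, k → j, a 2-cycle of the multigraph).
acyclicFrom : (ℕ → ℕ) → List Edge → Bool
acyclicFrom r []             = true
acyclicFrom r ((u , v) ∷ es) =
  if r u ≡ᵇ r v then false
  else acyclicFrom (λ x → if r x ≡ᵇ r v then r u else r x) es

undirectedAcyclic : List Edge → Bool
undirectedAcyclic = acyclicFrom (λ x → x)

outdegAtMostOne : List Edge → Bool
outdegAtMostOne F = all (λ e → length (filterᵇ (λ e′ → source e′ ≡ᵇ source e) F) ≤ᵇ 1) F

isIncomingForest : List Edge → Bool
isIncomingForest F = undirectedAcyclic F ∧ outdegAtMostOne F

reachesIn : ℕ → List Edge → ℕ → ℕ → Bool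
reachesIn zero     F s t = s ≡ᵇ t
reachesIn (suc f) F s t = (s ≡ᵇ t) ∨ any (λ e → (source e ≡ᵇ s) ∧ reachesIn f F (target e) t) F

-- F contains a directed path from s to t (a path uses at most |F| edges)
hasPath : List Edge → ℕ → ℕ → Bool
hasPath F s t = reachesIn (length F) F s t

forests : ℕ → List Edge → List (List Edge)
forests k E = filterᵇ (λ F → (length F ≡ᵇ k) ∧ isIncomingForest F) (sublists E)

forestsInOut : ℕ → ℕ → ℕ → List Edge → List (List Edge)
forestsInOut k i o E = filterᵇ (λ F → hasPath F i o) (forests k E)

-- Coefficients, with edge labels valued in a commutative ring:
-- a k j is the label a_{kj} of the edge j → k (a 0 j the leak label).

module Coeffs {c ℓ : Level} (R : CommutativeRing c ℓ) where
  open CommutativeRing R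

  Σ : List Carrier → Carrier
  Σ = foldr _+_ 0#

  Π : List Carrier → Carrier
  Π = foldr _*_ 1#

  productivity : (ℕ → ℕ → Carrier) → List Edge → Carrier
  productivity a F = Π (map (λ e → a (target e) (source e)) F)

  coeffC : Model → (ℕ → ℕ → Carrier) → ℕ → Carrier
  coeffC M a i = Σ (map (productivity a) (forests (size M ∸ i) (edgesG̃ M)))

  coeffD : Model → (ℕ → ℕ → Carrier) → ℕ → Carrier
  coeffD M a i = Σ (map (productivity a) (forestsInOut (size M ∸ i ∸ 1) (inp M) (out M) (edgesG̃* M)))

  σℕ : ℕ → List Carrier → Carrier
  σℕ zero    _        = 1#
  σℕ (suc k) []       = 0#
  σℕ (suc k) (x ∷ xs) = x * σℕ k xs + σℕ (suc k) xs

  σ : ℤ → List Carrier → Carrier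
  σ (+ k)    Q = σℕ k Q
  σ -[1+ k ] Q = 0#

edgesH : ℕ → List Edge
edgesH n = map (λ i → (suc i , suc (suc i))) (upTo (n ∸ 1)) ∷ʳ (n , n ∸ 1)

modelM : ℕ → Model
modelM n = record { size = n ; edges = edgesH n ; inp = 1 ; out = n ; leaks = [] }

-- Q_n \ {a_{n(n-1)}, a_{(n-1)n}} = { a_21, a_32, …, a_{(n-1)(n-2)} }
Qrest : {ℓa : Level} {A : Set ℓa} → (ℕ → ℕ → A) → ℕ → List A
Qrest a n = map (λ i → a (suc (suc i)) (suc i)) (upTo (n ∸ 2))

Qn : {ℓa : Level} {A : Set ℓa} → (ℕ → ℕ → A) → ℕ → List A
Qn a n = Qrest a n ++ (a n (n ∸ 1) ∷ a (n ∸ 1) n ∷ [])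

pathLabels : {ℓa : Level} {A : Set ℓa} → (ℕ → ℕ → A) → ℕ → List A
pathLabels a n = map (λ i → a (suc (suc i)) (suc i)) (upTo (n ∸ 1))

module Submission where

-- H is the path P_{n-1} : 1 → ⋯ → n-1 plus the 2-cycle n-1 ⇄ n.  A set of edges of H is an
-- incoming forest unless it contains both edges of the 2-cycle, so the forests with k edges
-- are the k-subsets of H minus those containing the 2-cycle, and summing productivities gives
-- σ_k(Q_n) - a_{n(n-1)} a_{(n-1)n} σ_{k-2}(Q_n ∖ {a_{n(n-1)}, a_{(n-1)n}}) for every k.
-- For k = n both terms are the product of all labels, so c_0 = 0.  Since H̃* is the path
-- 1 → ⋯ → n, the only edge set in it containing a path from 1 to n is the whole path;
-- hence d_i = 0 for i ≥ 1 and d_0 = a_21 ⋯ a_{n(n-1)}.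

open import Defs
open import Level using (Level)
open import Algebra.Bundles using (CommutativeRing)
open import Data.Bool using (true; false; if_then_else_; _∧_)
open import Data.Bool.Properties using (∧-identityʳ; ∧-zeroʳ)
open import Data.List using (List; []; _∷_; _++_; _∷ʳ_; map; length; filterᵇ; upTo)
open import Data.List.Properties using (++-identityʳ; length-map; length-++-comm; map-++; map-∘)
open import Data.List.Relation.Unary.All as All using (All; []; _∷_)
open import Data.Nat using (ℕ; zero; suc; _≤_; _<_; _∸_; _≡ᵇ_; z≤n; s≤s)
open import Data.Nat.Properties using (≤-refl; <⇒≢; m<n⇒m<1+n; n<1+n; ∸-monoˡ-≤; m∸n≤m)
open import Data.Product using (_×_; _,_)
open import Data.Integer using (+_) renaming (_-_ to _-ℤ_)
open import Relation.Binary.PropositionalEquality using (_≡_; refl; sym; trans; cong; cong₂; subst)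

module PathForests where
  open import Data.Bool using (Bool; not; T)
  open import Data.Bool.ListAction using (any)
  open import Data.Bool.Properties using (T-≡; T-∧; T-∨)
  open import Data.Empty using (⊥-elim)
  open import Data.List using (applyUpTo)
  open import Data.List.Properties using (++-assoc; map-upTo; applyUpTo-∷ʳ; filter-accept; filter-reject; filter-none)
  open import Data.List.Membership.Propositional using (_∈_)
  import Data.List.Relation.Unary.All.Properties as All
  open import Data.List.Relation.Unary.Any as Any using (here; there)
  open import Data.List.Relation.Unary.Any.Properties using (any⁺)
  open import Data.Nat using (_+_; _≤?_)
  open import Data.Nat.Properties
    using (≤-trans; ≤-reflexive; <-≤-trans; ≤-<-trans; <-irrefl; ≰⇒>; ≤∧≢⇒<; n≤1+n; m<m+n; +-suc; +-identityʳ; ≤⇒≤ᵇ; ≡⇒≡ᵇ)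
  open import Data.Product using (∃; proj₂)
  open import Data.Sum using (_⊎_; inj₁; inj₂)
  open import Function using (_∘_; id)
  open import Function.Bundles using (Equivalence)
  open import Relation.Binary.PropositionalEquality using (_≢_; module ≡-Reasoning)
  open import Relation.Nullary using (¬_; yes; no)
  open import Relation.Nullary.Decidable using (T?)

  ≡ᵇ-refl : ∀ m → (m ≡ᵇ m) ≡ true
  ≡ᵇ-refl zero    = refl
  ≡ᵇ-refl (suc m) = ≡ᵇ-refl m

  ≡ᵇ-true⇒≡ : ∀ {m n} → (m ≡ᵇ n) ≡ true → m ≡ n
  ≡ᵇ-true⇒≡ {zero}  {zero}  _  = refl
  ≡ᵇ-true⇒≡ {suc m} {suc n} eq = cong suc (≡ᵇ-true⇒≡ eq)

  ≢⇒≡ᵇ-false : ∀ {m n} → m ≢ n → (m ≡ᵇ n) ≡ false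
  ≢⇒≡ᵇ-false {zero}  {zero}  m≢n = ⊥-elim (m≢n refl)
  ≢⇒≡ᵇ-false {zero}  {suc n} _   = refl
  ≢⇒≡ᵇ-false {suc m} {zero}  _   = refl
  ≢⇒≡ᵇ-false {suc m} {suc n} m≢n = ≢⇒≡ᵇ-false (m≢n ∘ cong suc)

  path : ℕ → ℕ → List Edge
  path b zero    = []
  path b (suc k) = (b , suc b) ∷ path (suc b) k

  length-path : ∀ b k → length (path b k) ≡ k
  length-path b zero    = refl
  length-path b (suc k) = cong suc (length-path (suc b) k)

  applyUpTo-path : ∀ {g : ℕ → Edge} b k → (∀ i → g i ≡ (b + i , suc (b + i))) → applyUpTo g k ≡ path b k
  applyUpTo-path b zero    _  = refl
  applyUpTo-path b (suc k) g≗ = cong₂ _∷_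
    (trans (g≗ 0) (cong (λ v → v , suc v) (+-identityʳ b)))
    (applyUpTo-path (suc b) k (λ i → trans (g≗ (suc i)) (cong (λ v → v , suc v) (+-suc b i))))

  pathEdge : ℕ → Edge
  pathEdge i = (suc i , suc (suc i))

  backEdge : ℕ → Edge
  backEdge i = (suc (suc i) , suc i)

  upTo-path : ∀ k → applyUpTo pathEdge k ≡ path 1 k
  upTo-path k = applyUpTo-path 1 k (λ _ → refl)

  map-path : ∀ {ℓ} {A : Set ℓ} (f : Edge → A) k → map f (path 1 k) ≡ map (λ i → f (pathEdge i)) (upTo k)
  map-path f k = begin
    map f (path 1 k)            ≡⟨ cong (map f) (sym (trans (map-upTo pathEdge k) (upTo-path k))) ⟩
    map f (map pathEdge (upTo k))   ≡⟨ sym (map-∘ (upTo k)) ⟩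
    map (λ i → f (pathEdge i)) (upTo k) ∎
    where open ≡-Reasoning

  edgesG̃-modelM : ∀ p → edgesG̃ (modelM (suc (suc p))) ≡ path 1 p ++ pathEdge p ∷ backEdge p ∷ []
  edgesG̃-modelM p = begin
    (map pathEdge (upTo (suc p)) ∷ʳ back) ++ []  ≡⟨ ++-identityʳ _ ⟩
    map pathEdge (upTo (suc p)) ∷ʳ back          ≡⟨ cong (_∷ʳ back) (map-upTo pathEdge (suc p)) ⟩
    applyUpTo pathEdge (suc p) ∷ʳ back           ≡⟨ cong (_∷ʳ back) (sym (applyUpTo-∷ʳ pathEdge p)) ⟩
    (applyUpTo pathEdge p ∷ʳ pathEdge p) ∷ʳ back     ≡⟨ ++-assoc (applyUpTo pathEdge p) _ _ ⟩
    applyUpTo pathEdge p ++ pathEdge p ∷ back ∷ []   ≡⟨ cong (_++ pathEdge p ∷ back ∷ []) (upTo-path p) ⟩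
    path 1 p ++ pathEdge p ∷ back ∷ [] ∎
    where
    open ≡-Reasoning
    back : Edge
    back = backEdge p

  filterᵇ-path-++ : ∀ m b k X → b + k ≤ m →
    filterᵇ (λ e → not (source e ≡ᵇ m)) (path b k ++ X) ≡ path b k ++ filterᵇ (λ e → not (source e ≡ᵇ m)) X
  filterᵇ-path-++ m b zero    X _   = refl
  filterᵇ-path-++ m b (suc k) X b+k≤m
    rewrite ≢⇒≡ᵇ-false (<⇒≢ (<-≤-trans (m<m+n b (s≤s z≤n)) b+k≤m)) =
    cong ((b , suc b) ∷_) (filterᵇ-path-++ m (suc b) k X (≤-trans (≤-reflexive (sym (+-suc b k))) b+k≤m))

  edgesG̃*-modelM : ∀ p → edgesG̃* (modelM (suc (suc p))) ≡ path 1 (suc p)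
  edgesG̃*-modelM p = begin
    filterᵇ leaves≢n ((map pathEdge (upTo (suc p)) ∷ʳ back) ++ [])
      ≡⟨ cong (filterᵇ leaves≢n) (trans (++-identityʳ _) (cong (_∷ʳ back) (trans (map-upTo pathEdge (suc p)) (upTo-path (suc p))))) ⟩
    filterᵇ leaves≢n (path 1 (suc p) ∷ʳ back)
      ≡⟨ filterᵇ-path-++ (suc (suc p)) 1 (suc p) (back ∷ []) ≤-refl ⟩
    path 1 (suc p) ++ filterᵇ leaves≢n (back ∷ [])  ≡⟨ cong (path 1 (suc p) ++_) back-removed ⟩
    path 1 (suc p) ++ []                            ≡⟨ ++-identityʳ _ ⟩
    path 1 (suc p) ∎
    where
    open ≡-Reasoning
    back : Edge
    back = backEdge p
    leaves≢n : Edge → Bool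
    leaves≢n e = not (source e ≡ᵇ suc (suc p))
    back-removed : filterᵇ leaves≢n (back ∷ []) ≡ []
    back-removed rewrite ≡ᵇ-refl p = refl

  data Ascending : ℕ → ℕ → List Edge → Set where
    []  : ∀ {b t} → b ≤ t → Ascending b t []
    _∷_ : ∀ {b t u F} → b ≤ u → Ascending (suc u) t F → Ascending b t ((u , suc u) ∷ F)

  Ascending-weaken : ∀ {b′ b t F} → b′ ≤ b → Ascending b t F → Ascending b′ t F
  Ascending-weaken b′≤b ([] b≤t)    = [] (≤-trans b′≤b b≤t)
  Ascending-weaken b′≤b (b≤u ∷ asc) = ≤-trans b′≤b b≤u ∷ asc

  Ascending-∷ʳ : ∀ {b t u F} → Ascending b t F → t ≤ u → Ascending b (suc u) (F ∷ʳ (u , suc u))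
  Ascending-∷ʳ ([] b≤t)    t≤u = ≤-trans b≤t t≤u ∷ [] ≤-refl
  Ascending-∷ʳ (b≤u ∷ asc) t≤u = b≤u ∷ Ascending-∷ʳ asc t≤u

  Ascending-path : ∀ b k → Ascending b (b + k) (path b k)
  Ascending-path b zero    = [] (≤-reflexive (sym (+-identityʳ b)))
  Ascending-path b (suc k) rewrite +-suc b k = ≤-refl ∷ Ascending-path (suc b) k

  Ascending-sublists : ∀ b k → All (Ascending b (b + k)) (sublists (path b k))
  Ascending-sublists b zero    = [] (≤-reflexive (sym (+-identityʳ b))) ∷ []
  Ascending-sublists b (suc k) rewrite +-suc b k =
    All.++⁺ (All.map⁺ (All.map (≤-refl ∷_) (Ascending-sublists (suc b) k)))
            (All.map (Ascending-weaken (n≤1+n b)) (Ascending-sublists (suc b) k))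

  Ascending-sources : ∀ {b t F} → Ascending b t F → All (λ e → b ≤ source e) F
  Ascending-sources ([] _)      = []
  Ascending-sources (b≤u ∷ asc) = b≤u ∷ All.map (λ u<v → ≤-trans b≤u (≤-trans (n≤1+n _) u<v)) (Ascending-sources asc)

  Ascending-unitSteps : ∀ {b t F} → Ascending b t F → All (λ e → target e ≡ suc (source e)) F
  Ascending-unitSteps ([] _)    = []
  Ascending-unitSteps (_ ∷ asc) = refl ∷ Ascending-unitSteps asc

  -- Invariant of the representative map r of acyclicFrom while an ascending list is
  -- processed: vertices ≥ c are still singletons, vertices < c have representatives < c.
  -- Each new edge (u , 1 + u) then joins a singleton, so it never closes a cycle.
  MergedBelow : ℕ → (ℕ → ℕ) → Set
  MergedBelow c r = (∀ x → c ≤ x → r x ≡ x) × (∀ x → x < c → r x < c)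

  MergedBelow-id : ∀ c → MergedBelow c (λ x → x)
  MergedBelow-id c = (λ _ _ → refl) , (λ _ x<c → x<c)

  MergedBelow-mono : ∀ {c c′ r} → c ≤ c′ → MergedBelow c r → MergedBelow c′ r
  MergedBelow-mono {c} {c′} {r} c≤c′ (fixed , below) = (λ x c′≤x → fixed x (≤-trans c≤c′ c′≤x)) , below′
    where
    below′ : ∀ x → x < c′ → r x < c′
    below′ x x<c′ with c ≤? x
    ... | yes c≤x rewrite fixed x c≤x = x<c′
    ... | no  c≰x = <-≤-trans (below x (≰⇒> c≰x)) c≤c′

  merge : (ℕ → ℕ) → ℕ → ℕ → ℕ → ℕ
  merge r u v x = if r x ≡ᵇ r v then r u else r x

  merge-pathEdge : ∀ {u r} → MergedBelow (suc u) r →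
    (r u ≡ᵇ r (suc u)) ≡ false × MergedBelow (suc (suc u)) (merge r u (suc u))
  merge-pathEdge {u} {r} (fixed , below) = ≢⇒≡ᵇ-false (λ eq → <⇒≢ ru<1+u (trans eq r[1+u])) , fixed′ , below′
    where
    r[1+u] : r (suc u) ≡ suc u
    r[1+u] = fixed (suc u) ≤-refl
    ru<1+u : r u < suc u
    ru<1+u = below u ≤-refl
    fixed′ : ∀ x → suc (suc u) ≤ x → merge r u (suc u) x ≡ x
    fixed′ x 2+u≤x rewrite r[1+u] | fixed x (≤-trans (n≤1+n _) 2+u≤x)
      | ≢⇒≡ᵇ-false {x} {suc u} (λ eq → <-irrefl (sym eq) 2+u≤x) = refl
    below′ : ∀ x → x < suc (suc u) → merge r u (suc u) x < suc (suc u)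
    below′ x x<2+u with r x ≡ᵇ r (suc u)
    ... | true  = ≤-trans ru<1+u (n≤1+n _)
    ... | false = proj₂ (MergedBelow-mono (n≤1+n _) (fixed , below)) x x<2+u

  acyclicFrom-ascending : ∀ {b t F r} X → Ascending b t F → MergedBelow (suc b) r →
    ∃ λ r′ → MergedBelow (suc t) r′ × acyclicFrom r (F ++ X) ≡ acyclicFrom r′ X
  acyclicFrom-ascending {r = r} X ([] b≤t) merged = r , MergedBelow-mono (s≤s b≤t) merged , refl
  acyclicFrom-ascending X (b≤u ∷ asc) merged with merge-pathEdge (MergedBelow-mono (s≤s b≤u) merged)
  ... | distinct , merged′ rewrite distinct = acyclicFrom-ascending X asc merged′

  acyclicFrom-back : ∀ {t r} → MergedBelow (suc t) r → acyclicFrom r ((suc t , t) ∷ []) ≡ true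
  acyclicFrom-back {t} {r} (fixed , below)
    rewrite fixed (suc t) ≤-refl | ≢⇒≡ᵇ-false {suc t} {r t} (λ eq → <⇒≢ (below t ≤-refl) (sym eq)) = refl

  acyclicFrom-antiparallel : ∀ r F u v es → acyclicFrom r (F ++ (u , v) ∷ (v , u) ∷ es) ≡ false
  acyclicFrom-antiparallel r [] u v es with r u ≡ᵇ r v
  ... | true  = refl
  ... | false rewrite ≡ᵇ-refl (r v) | ≡ᵇ-refl (r u) = refl
  acyclicFrom-antiparallel r ((x , y) ∷ F) u v es with r x ≡ᵇ r y
  ... | true  = refl
  ... | false = acyclicFrom-antiparallel (merge r x y) F u v es

  data SourcesAbove : ℕ → List Edge → Set where
    []  : ∀ {b} → SourcesAbove b []
    _∷_ : ∀ {b e F} → b ≤ source e → SourcesAbove (suc (source e)) F → SourcesAbove b (e ∷ F)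

  SourcesAbove-weaken : ∀ {b′ b F} → b′ ≤ b → SourcesAbove b F → SourcesAbove b′ F
  SourcesAbove-weaken b′≤b []           = []
  SourcesAbove-weaken b′≤b (b≤s ∷ srcs) = ≤-trans b′≤b b≤s ∷ srcs

  Ascending-++-SourcesAbove : ∀ {b t F X} → Ascending b t F → SourcesAbove t X → SourcesAbove b (F ++ X)
  Ascending-++-SourcesAbove ([] b≤t)    srcs = SourcesAbove-weaken b≤t srcs
  Ascending-++-SourcesAbove (b≤u ∷ asc) srcs = b≤u ∷ Ascending-++-SourcesAbove asc srcs

  outdegree : ℕ → List Edge → ℕ
  outdegree s F = length (filterᵇ (λ e → source e ≡ᵇ s) F)

  SourcesAbove-outdegree≡0 : ∀ {b F} s → s < b → SourcesAbove b F → outdegree s F ≡ 0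
  SourcesAbove-outdegree≡0 s s<b [] = refl
  SourcesAbove-outdegree≡0 s s<b (_∷_ {e = e} b≤src srcs) with source e ≡ᵇ s in eq
  ... | true  = ⊥-elim (<-irrefl (sym (≡ᵇ-true⇒≡ eq)) (<-≤-trans s<b b≤src))
  ... | false = SourcesAbove-outdegree≡0 s (≤-trans s<b (≤-trans b≤src (n≤1+n _))) srcs

  SourcesAbove-outdegree≤1 : ∀ {b F} s → SourcesAbove b F → outdegree s F ≤ 1
  SourcesAbove-outdegree≤1 s [] = z≤n
  SourcesAbove-outdegree≤1 s (_∷_ {e = e} _ srcs) with source e ≡ᵇ s in eq
  ... | true rewrite SourcesAbove-outdegree≡0 s (≤-reflexive (cong suc (sym (≡ᵇ-true⇒≡ eq)))) srcs = ≤-refl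
  ... | false = SourcesAbove-outdegree≤1 s srcs

  SourcesAbove-outdegAtMostOne : ∀ {b F} → SourcesAbove b F → outdegAtMostOne F ≡ true
  SourcesAbove-outdegAtMostOne {F = F} srcs =
    Equivalence.to T-≡ (All.all⁻ _ {F} (All.universal (λ e → ≤⇒≤ᵇ (SourcesAbove-outdegree≤1 (source e) srcs)) F))

  isIncomingForest-ascending-++ : ∀ {b t F} X → Ascending b t F →
    (∀ {r} → MergedBelow (suc t) r → acyclicFrom r X ≡ true) → SourcesAbove t X →
    isIncomingForest (F ++ X) ≡ true
  isIncomingForest-ascending-++ X asc acyclicX srcsX
    with acyclicFrom-ascending X asc (MergedBelow-id _)
  ... | r′ , merged′ , eq
    rewrite eq | acyclicX merged′ | SourcesAbove-outdegAtMostOne (Ascending-++-SourcesAbove asc srcsX) = refl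

  isIncomingForest-ascending : ∀ {b t F} → Ascending b t F → isIncomingForest F ≡ true
  isIncomingForest-ascending {F = F} asc =
    subst (λ G → isIncomingForest G ≡ true) (++-identityʳ F) (isIncomingForest-ascending-++ [] asc (λ _ → refl) [])

  isIncomingForest-ascending-back : ∀ {b t F} → Ascending b t F → isIncomingForest (F ++ (suc t , t) ∷ []) ≡ true
  isIncomingForest-ascending-back asc = isIncomingForest-ascending-++ _ asc acyclicFrom-back (n≤1+n _ ∷ [])

  isIncomingForest-antiparallel : ∀ F u v → isIncomingForest (F ++ (u , v) ∷ (v , u) ∷ []) ≡ false
  isIncomingForest-antiparallel F u v rewrite acyclicFrom-antiparallel (λ x → x) F u v [] = refl

  Gap : ℕ → ℕ → List Edge → Set
  Gap b k F = ∃ λ v → b ≤ v × v < b + k × All (λ e → source e ≢ v) F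

  sublists-path-full⊎gap : ∀ b k → All (λ F → length F ≡ k ⊎ Gap b k F) (sublists (path b k))
  sublists-path-full⊎gap b zero    = inj₁ refl ∷ []
  sublists-path-full⊎gap b (suc k) =
    All.++⁺ (All.map⁺ (All.map with-b (sublists-path-full⊎gap (suc b) k)))
            (All.map without-b (Ascending-sublists (suc b) k))
    where
    with-b : ∀ {F} → length F ≡ k ⊎ Gap (suc b) k F →
      length ((b , suc b) ∷ F) ≡ suc k ⊎ Gap b (suc k) ((b , suc b) ∷ F)
    with-b (inj₁ full) = inj₁ (cong suc full)
    with-b (inj₂ (v , b<v , v<b+k , gap)) =
      inj₂ (v , ≤-trans (n≤1+n b) b<v , subst (v <_) (sym (+-suc b k)) v<b+k , (λ b≡v → <-irrefl b≡v b<v) ∷ gap)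
    without-b : ∀ {F} → Ascending (suc b) (suc b + k) F → length F ≡ suc k ⊎ Gap b (suc k) F
    without-b asc = inj₂ (b , ≤-refl , m<m+n b (s≤s z≤n) , All.map (λ b<s s≡b → <-irrefl (sym s≡b) b<s) (Ascending-sources asc))

  reachesIn-gap : ∀ {v} F → All (λ e → target e ≡ suc (source e)) F → All (λ e → source e ≢ v) F →
    ∀ f s t → s ≤ v → v < t → reachesIn f F s t ≡ false
  reachesIn-gap F unit gap zero    s t s≤v v<t = ≢⇒≡ᵇ-false (<⇒≢ (≤-<-trans s≤v v<t))
  reachesIn-gap {v} F unit gap (suc f) s t s≤v v<t rewrite ≢⇒≡ᵇ-false (<⇒≢ (≤-<-trans s≤v v<t)) = no-pathEdge F unit gap
    where
    target≤v : ∀ {e} → target e ≡ suc (source e) → source e ≡ s → source e ≢ v → target e ≤ v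
    target≤v unitₑ refl e≢v rewrite unitₑ = ≤∧≢⇒< s≤v e≢v
    no-pathEdge : ∀ G → All (λ e → target e ≡ suc (source e)) G → All (λ e → source e ≢ v) G →
      any (λ e → (source e ≡ᵇ s) ∧ reachesIn f F (target e) t) G ≡ false
    no-pathEdge []      []            []          = refl
    no-pathEdge (e ∷ G) (unitₑ ∷ units) (e≢v ∷ gaps) with source e ≡ᵇ s in eq
    ... | false = no-pathEdge G units gaps
    ... | true  rewrite reachesIn-gap F unit gap f (target e) t (target≤v unitₑ (≡ᵇ-true⇒≡ eq) e≢v) v<t =
      no-pathEdge G units gaps

  reachesIn-path : ∀ F b k → (∀ {e} → e ∈ path b k → e ∈ F) → T (reachesIn k F b (b + k))
  reachesIn-path F b zero    _      = ≡⇒≡ᵇ b (b + 0) (sym (+-identityʳ b))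
  reachesIn-path F b (suc k) path⊆F =
    Equivalence.from T-∨ (inj₂ (any⁺ _ (Any.map (λ { refl → first-pathEdge }) (path⊆F (here refl)))))
    where
    first-pathEdge : T ((b ≡ᵇ b) ∧ reachesIn k F (suc b) (b + suc k))
    first-pathEdge = Equivalence.from T-∧
      (≡⇒≡ᵇ b b refl , subst (T ∘ reachesIn k F (suc b)) (sym (+-suc b k)) (reachesIn-path F (suc b) k (path⊆F ∘ there)))

  sublists-length : ∀ {A : Set} (xs : List A) → All (λ ys → length ys ≤ length xs) (sublists xs)
  sublists-length []       = z≤n ∷ []
  sublists-length (x ∷ xs) =
    All.++⁺ (All.map⁺ (All.map s≤s (sublists-length xs))) (All.map (λ ≤xs → ≤-trans ≤xs (n≤1+n _)) (sublists-length xs))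

  sublists-head : ∀ {A : Set} (xs : List A) →
    ∃ λ rest → sublists xs ≡ xs ∷ rest × All (λ ys → length ys < length xs) rest
  sublists-head []       = [] , refl , []
  sublists-head (x ∷ xs) with sublists-head xs
  ... | rest , eq , shorter =
    map (x ∷_) rest ++ sublists xs , cong (λ yss → map (x ∷_) yss ++ sublists xs) eq ,
    All.++⁺ (All.map⁺ (All.map s≤s shorter)) (All.map s≤s (sublists-length xs))

  filterᵇ-comm : ∀ {A : Set} (p q : A → Bool) xs → filterᵇ p (filterᵇ q xs) ≡ filterᵇ q (filterᵇ p xs)
  filterᵇ-comm p q []       = refl
  filterᵇ-comm p q (x ∷ xs) with p x in px | q x in qx
  ... | true  | true  rewrite px | qx = cong (x ∷_) (filterᵇ-comm p q xs)
  ... | true  | false rewrite qx      = filterᵇ-comm p q xs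
  ... | false | true  rewrite px      = filterᵇ-comm p q xs
  ... | false | false                 = filterᵇ-comm p q xs

  filterᵇ-hasPath-sublists-path : ∀ b k → filterᵇ (λ F → hasPath F b (b + k)) (sublists (path b k)) ≡ path b k ∷ []
  filterᵇ-hasPath-sublists-path b k with sublists-head (path b k)
  ... | rest , eq , shorter rewrite eq =
    trans (filter-accept (T? ∘ reaches) path-reaches)
          (cong (path b k ∷_) (filter-none (T? ∘ reaches) (All.zipWith misses (shorter , facts))))
    where
    reaches : List Edge → Bool
    reaches F = hasPath F b (b + k)
    path-reaches : T (reaches (path b k))
    path-reaches = subst (λ f → T (reachesIn f (path b k) b (b + k))) (sym (length-path b k)) (reachesIn-path (path b k) b k id)
    facts : All (λ F → Ascending b (b + k) F × (length F ≡ k ⊎ Gap b k F)) rest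
    facts with subst (All _) eq (All.zip (Ascending-sublists b k , sublists-path-full⊎gap b k))
    ... | _ ∷ facts = facts
    misses : ∀ {F} → length F < length (path b k) × Ascending b (b + k) F × (length F ≡ k ⊎ Gap b k F) → ¬ T (reaches F)
    misses (shorter , _ , inj₁ full) = ⊥-elim (<⇒≢ shorter (trans full (sym (length-path b k))))
    misses {F} (_ , asc , inj₂ (v , b≤v , v<b+k , gap)) =
      subst T (reachesIn-gap F (Ascending-unitSteps asc) gap (length F) b (b + k) b≤v v<b+k)

  isForestOfSize : ℕ → List Edge → Bool
  isForestOfSize k F = (length F ≡ᵇ k) ∧ isIncomingForest F

  forestsInOut-path : ∀ k b m → forestsInOut k b (b + m) (path b m) ≡ filterᵇ (isForestOfSize k) (path b m ∷ [])
  forestsInOut-path k b m =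
    trans (filterᵇ-comm _ _ (sublists (path b m))) (cong (filterᵇ _) (filterᵇ-hasPath-sublists-path b m))

  forestsInOut-path-full : ∀ b m → forestsInOut m b (b + m) (path b m) ≡ path b m ∷ []
  forestsInOut-path-full b m = trans (forestsInOut-path m b m) (filter-accept (T? ∘ isForestOfSize m) {path b m} {[]} (Equivalence.from T-≡ accepted))
    where
    accepted : isForestOfSize m (path b m) ≡ true
    accepted rewrite length-path b m | ≡ᵇ-refl m | isIncomingForest-ascending (Ascending-path b m) = refl

  forestsInOut-path-≢ : ∀ k b m → k ≢ m → forestsInOut k b (b + m) (path b m) ≡ []
  forestsInOut-path-≢ k b m k≢m = trans (forestsInOut-path k b m) (filter-reject (T? ∘ isForestOfSize k) {path b m} {[]} (subst T rejected))
    where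
    rejected : isForestOfSize k (path b m) ≡ false
    rejected rewrite length-path b m | ≢⇒≡ᵇ-false (k≢m ∘ sym) = refl

open PathForests

module ListSums {c ℓ : Level} (R : CommutativeRing c ℓ) where
  open CommutativeRing R hiding (zero) renaming (refl to ≈-refl; sym to ≈-sym; trans to ≈-trans)
  open Coeffs R
  open import Algebra.Properties.CommutativeSemigroup +-commutativeSemigroup using (interchange)
  open import Relation.Binary.Reasoning.Setoid setoid

  Σ-++ : ∀ xs ys → Σ (xs ++ ys) ≈ Σ xs + Σ ys
  Σ-++ []       ys = ≈-sym (+-identityˡ _)
  Σ-++ (x ∷ xs) ys = ≈-trans (+-congˡ (Σ-++ xs ys)) (≈-sym (+-assoc _ _ _))

  Π-++ : ∀ xs ys → Π (xs ++ ys) ≈ Π xs * Π ys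
  Π-++ []       ys = ≈-sym (*-identityˡ _)
  Π-++ (x ∷ xs) ys = ≈-trans (*-congˡ (Π-++ xs ys)) (≈-sym (*-assoc _ _ _))

  Σ-map-cong : ∀ {A : Set} {f g : A → Carrier} xs → All (λ x → f x ≈ g x) xs → Σ (map f xs) ≈ Σ (map g xs)
  Σ-map-cong []       []              = ≈-refl
  Σ-map-cong (x ∷ xs) (fx≈gx ∷ rest) = +-cong fx≈gx (Σ-map-cong xs rest)

  Σ-map-0 : ∀ {A : Set} (xs : List A) → Σ (map (λ _ → 0#) xs) ≈ 0#
  Σ-map-0 []       = ≈-refl
  Σ-map-0 (x ∷ xs) = ≈-trans (+-identityˡ _) (Σ-map-0 xs)

  Σ-map-+ : ∀ {A : Set} (f g : A → Carrier) xs → Σ (map (λ x → f x + g x) xs) ≈ Σ (map f xs) + Σ (map g xs)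
  Σ-map-+ f g []       = ≈-sym (+-identityˡ _)
  Σ-map-+ f g (x ∷ xs) = ≈-trans (+-congˡ (Σ-map-+ f g xs)) (interchange _ _ _ _)

  Σ-map-*ˡ : ∀ {A : Set} k (f : A → Carrier) xs → Σ (map (λ x → k * f x) xs) ≈ k * Σ (map f xs)
  Σ-map-*ˡ k f []       = ≈-sym (zeroʳ k)
  Σ-map-*ˡ k f (x ∷ xs) = ≈-trans (+-congˡ (Σ-map-*ˡ k f xs)) (≈-sym (distribˡ k _ _))

  Σ-map-filterᵇ : ∀ {A : Set} (f : A → Carrier) q xs →
    Σ (map f (filterᵇ q xs)) ≈ Σ (map (λ x → if q x then f x else 0#) xs)
  Σ-map-filterᵇ f q []       = ≈-refl
  Σ-map-filterᵇ f q (x ∷ xs) with q x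
  ... | true  = +-congˡ (Σ-map-filterᵇ f q xs)
  ... | false = ≈-trans (Σ-map-filterᵇ f q xs) (≈-sym (+-identityˡ _))

  sublistSum : ∀ {A : Set} → (List A → Carrier) → List A → Carrier
  sublistSum w xs = Σ (map w (sublists xs))

  sublistSum-∷ : ∀ {A : Set} (w : List A → Carrier) x xs →
    sublistSum w (x ∷ xs) ≈ sublistSum (λ ys → w (x ∷ ys)) xs + sublistSum w xs
  sublistSum-∷ w x xs = begin
    Σ (map w (map (x ∷_) (sublists xs) ++ sublists xs))
      ≡⟨ cong Σ (map-++ w (map (x ∷_) (sublists xs)) (sublists xs)) ⟩
    Σ (map w (map (x ∷_) (sublists xs)) ++ map w (sublists xs))
      ≈⟨ Σ-++ (map w (map (x ∷_) (sublists xs))) _ ⟩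
    Σ (map w (map (x ∷_) (sublists xs))) + sublistSum w xs
      ≡⟨ cong (λ ws → Σ ws + sublistSum w xs) (sym (map-∘ (sublists xs))) ⟩
    sublistSum (λ ys → w (x ∷ ys)) xs + sublistSum w xs ∎

  sublistSum-++ : ∀ {A : Set} (w : List A → Carrier) xs ys →
    sublistSum w (xs ++ ys) ≈ sublistSum (λ F → sublistSum (λ G → w (F ++ G)) ys) xs
  sublistSum-++ w []       ys = ≈-sym (+-identityʳ _)
  sublistSum-++ w (x ∷ xs) ys = begin
    sublistSum w (x ∷ xs ++ ys)
      ≈⟨ sublistSum-∷ w x (xs ++ ys) ⟩
    sublistSum (λ F → w (x ∷ F)) (xs ++ ys) + sublistSum w (xs ++ ys)
      ≈⟨ +-cong (sublistSum-++ (λ F → w (x ∷ F)) xs ys) (sublistSum-++ w xs ys) ⟩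
    sublistSum (λ F → sublistSum (λ G → w (x ∷ F ++ G)) ys) xs + sublistSum (λ F → sublistSum (λ G → w (F ++ G)) ys) xs
      ≈⟨ sublistSum-∷ (λ F → sublistSum (λ G → w (F ++ G)) ys) x xs ⟨
    sublistSum (λ F → sublistSum (λ G → w (F ++ G)) ys) (x ∷ xs) ∎

  ofLength : ∀ {A : Set} → ℕ → (List A → Carrier) → List A → Carrier
  ofLength k w ys = if length ys ≡ᵇ k then w ys else 0#

  if-*ˡ : ∀ b x y → (if b then x * y else 0#) ≈ x * (if b then y else 0#)
  if-*ˡ true  x y = ≈-refl
  if-*ˡ false x y = ≈-sym (zeroʳ x)

  σℕ-sublistSum : ∀ {A : Set} (f : A → Carrier) xs k →
    σℕ k (map f xs) ≈ sublistSum (ofLength k (λ ys → Π (map f ys))) xs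
  σℕ-sublistSum f []       zero    = ≈-sym (+-identityʳ _)
  σℕ-sublistSum f []       (suc k) = ≈-sym (+-identityʳ _)
  σℕ-sublistSum f (x ∷ xs) zero    = begin
    1#                                     ≈⟨ +-identityˡ _ ⟨
    0# + 1#                                ≈⟨ +-cong (Σ-map-0 (sublists xs)) (≈-sym (σℕ-sublistSum f xs zero)) ⟨
    sublistSum (λ ys → ofLength 0 Πf (x ∷ ys)) xs + sublistSum (ofLength 0 Πf) xs
                                           ≈⟨ sublistSum-∷ (ofLength 0 Πf) x xs ⟨
    sublistSum (ofLength 0 Πf) (x ∷ xs)    ∎
    where
    Πf : List _ → Carrier
    Πf ys = Π (map f ys)
  σℕ-sublistSum f (x ∷ xs) (suc k) = begin
    f x * σℕ k (map f xs) + σℕ (suc k) (map f xs)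
      ≈⟨ +-cong (*-congˡ (σℕ-sublistSum f xs k)) (σℕ-sublistSum f xs (suc k)) ⟩
    f x * sublistSum (ofLength k Πf) xs + sublistSum (ofLength (suc k) Πf) xs
      ≈⟨ +-congʳ (Σ-map-*ˡ (f x) (ofLength k Πf) (sublists xs)) ⟨
    Σ (map (λ ys → f x * ofLength k Πf ys) (sublists xs)) + sublistSum (ofLength (suc k) Πf) xs
      ≈⟨ +-congʳ (Σ-map-cong (sublists xs) (All.universal (λ ys → if-*ˡ (length ys ≡ᵇ k) (f x) (Πf ys)) _)) ⟨
    sublistSum (λ ys → ofLength (suc k) Πf (x ∷ ys)) xs + sublistSum (ofLength (suc k) Πf) xs
      ≈⟨ sublistSum-∷ (ofLength (suc k) Πf) x xs ⟨
    sublistSum (ofLength (suc k) Πf) (x ∷ xs) ∎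
    where
    Πf : List _ → Carrier
    Πf ys = Π (map f ys)

  σℕ-beyond : ∀ xs k → length xs < k → σℕ k xs ≈ 0#
  σℕ-beyond []       (suc k) _           = ≈-refl
  σℕ-beyond (x ∷ xs) (suc k) (s≤s xs<k) = begin
    x * σℕ k xs + σℕ (suc k) xs  ≈⟨ +-cong (*-congˡ (σℕ-beyond xs k xs<k)) (σℕ-beyond xs (suc k) (m<n⇒m<1+n xs<k)) ⟩
    x * 0# + 0#                  ≈⟨ +-identityʳ _ ⟩
    x * 0#                       ≈⟨ zeroʳ x ⟩
    0#                           ∎

  σℕ-length : ∀ {m} xs → length xs ≡ m → σℕ m xs ≈ Π xs
  σℕ-length []       refl = ≈-refl
  σℕ-length (x ∷ xs) refl = begin
    x * σℕ (length xs) xs + σℕ (suc (length xs)) xs  ≈⟨ +-cong (*-congˡ (σℕ-length xs refl)) (σℕ-beyond xs _ (n<1+n _)) ⟩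
    x * Π xs + 0#                                    ≈⟨ +-identityʳ _ ⟩
    x * Π xs                                         ∎

  ofLength-length : ∀ {A : Set} {m} k (w : List A → Carrier) ys → length ys ≡ m →
    ofLength k w ys ≡ (if m ≡ᵇ k then w ys else 0#)
  ofLength-length k w ys refl = refl

module ModelCoefficients {c ℓ : Level} (R : CommutativeRing c ℓ) (a : ℕ → ℕ → CommutativeRing.Carrier R) (p : ℕ) where
  open CommutativeRing R hiding (zero) renaming (refl to ≈-refl; sym to ≈-sym; trans to ≈-trans)
  open Coeffs R
  open ListSums R
  open import Algebra.Properties.AbelianGroup +-abelianGroup using (xyx⁻¹≈y)
  open import Relation.Binary.Reasoning.Setoid setoid

  n : ℕ
  n = suc (suc p)

  label : Edge → Carrier
  label e = a (target e) (source e)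

  π : List Edge → Carrier
  π = productivity a

  forward back : Edge
  forward = pathEdge p
  back    = backEdge p

  cycle : List Edge
  cycle = forward ∷ back ∷ []

  cycleProduct : Carrier
  cycleProduct = label forward * label back

  H : List Edge
  H = path 1 p ++ cycle

  forestSum : ℕ → Carrier
  forestSum k = Σ (map π (forests k H))

  forestWeight : ℕ → List Edge → Carrier
  forestWeight k F = if isForestOfSize k F then π F else 0#

  forestWeight-forest : ∀ k F → isIncomingForest F ≡ true → forestWeight k F ≡ ofLength k π F
  forestWeight-forest k F forest rewrite forest | ∧-identityʳ (length F ≡ᵇ k) = refl

  forestWeight-nonforest : ∀ k F → isIncomingForest F ≡ false → forestWeight k F ≡ 0#
  forestWeight-nonforest k F nonforest rewrite nonforest | ∧-zeroʳ (length F ≡ᵇ k) = refl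

  -- Of the four ways to extend F ⊆ P_{n-1} by edges of the 2-cycle, only adding both fails to give a forest.
  cycle-extensions : ∀ k F → Ascending 1 (suc p) F →
    sublistSum (λ G → ofLength k π (F ++ G)) cycle ≈ ofLength k π (F ++ cycle) + sublistSum (λ G → forestWeight k (F ++ G)) cycle
  cycle-extensions k F asc = +-congˡ (≈-sym (begin
    forestWeight k (F ++ cycle) + (forestWeight k (F ∷ʳ forward) + (forestWeight k (F ∷ʳ back) + (forestWeight k (F ++ []) + 0#)))
      ≡⟨ cong₂ _+_ (forestWeight-nonforest k (F ++ cycle) (isIncomingForest-antiparallel F (suc p) n))
           (cong₂ _+_ (forestWeight-forest k (F ∷ʳ forward) (isIncomingForest-ascending (Ascending-∷ʳ asc ≤-refl)))
             (cong₂ _+_ (forestWeight-forest k (F ∷ʳ back) (isIncomingForest-ascending-back asc))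
               (cong₂ _+_ (forestWeight-forest k (F ++ []) forest-F++[]) refl))) ⟩
    0# + (ofLength k π (F ∷ʳ forward) + (ofLength k π (F ∷ʳ back) + (ofLength k π (F ++ []) + 0#)))
      ≈⟨ +-identityˡ _ ⟩
    ofLength k π (F ∷ʳ forward) + (ofLength k π (F ∷ʳ back) + (ofLength k π (F ++ []) + 0#))
      ∎))
    where
    forest-F++[] : isIncomingForest (F ++ []) ≡ true
    forest-F++[] = subst (λ G → isIncomingForest G ≡ true) (sym (++-identityʳ F)) (isIncomingForest-ascending asc)

  cyclePart : ℕ → Carrier
  cyclePart k = sublistSum (λ F → ofLength k π (F ++ cycle)) (path 1 p)

  σℕ-H-split : ∀ k → σℕ k (map label H) ≈ cyclePart k + forestSum k
  σℕ-H-split k = begin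
    σℕ k (map label H)
      ≈⟨ σℕ-sublistSum label H k ⟩
    sublistSum (ofLength k π) (path 1 p ++ cycle)
      ≈⟨ sublistSum-++ (ofLength k π) (path 1 p) cycle ⟩
    sublistSum (λ F → sublistSum (λ G → ofLength k π (F ++ G)) cycle) (path 1 p)
      ≈⟨ Σ-map-cong (sublists (path 1 p)) (All.map (cycle-extensions k _) (Ascending-sublists 1 p)) ⟩
    Σ (map (λ F → ofLength k π (F ++ cycle) + sublistSum (λ G → forestWeight k (F ++ G)) cycle) (sublists (path 1 p)))
      ≈⟨ Σ-map-+ _ _ (sublists (path 1 p)) ⟩
    cyclePart k + sublistSum (λ F → sublistSum (λ G → forestWeight k (F ++ G)) cycle) (path 1 p)
      ≈⟨ +-congˡ (sublistSum-++ (forestWeight k) (path 1 p) cycle) ⟨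
    cyclePart k + sublistSum (forestWeight k) H
      ≈⟨ +-congˡ (Σ-map-filterᵇ π _ (sublists H)) ⟨
    cyclePart k + forestSum k ∎

  π-++-cycle : ∀ F → π (F ++ cycle) ≈ cycleProduct * π F
  π-++-cycle F = begin
    π (F ++ cycle)                                ≡⟨ cong Π (map-++ label F cycle) ⟩
    Π (map label F ++ map label cycle)            ≈⟨ Π-++ (map label F) (map label cycle) ⟩
    π F * (label forward * (label back * 1#))     ≈⟨ *-congˡ (*-congˡ (*-identityʳ _)) ⟩
    π F * cycleProduct            ≈⟨ *-comm _ _ ⟩
    cycleProduct * π F            ∎

  ofLength-++-cycle : ∀ k F → ofLength (suc (suc k)) π (F ++ cycle) ≈ cycleProduct * ofLength k π F
  ofLength-++-cycle k F rewrite ofLength-length (suc (suc k)) π (F ++ cycle) (length-++-comm F cycle) with length F ≡ᵇ k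
  ... | true  = π-++-cycle F
  ... | false = ≈-sym (zeroʳ _)

  ofLength-++-cycle-short : ∀ k F → k < 2 → ofLength k π (F ++ cycle) ≡ 0#
  ofLength-++-cycle-short zero       F _ = ofLength-length 0 π (F ++ cycle) (length-++-comm F cycle)
  ofLength-++-cycle-short (suc zero) F _ = ofLength-length 1 π (F ++ cycle) (length-++-comm F cycle)
  ofLength-++-cycle-short (suc (suc k)) F (s≤s (s≤s ()))

  cyclePart-short : ∀ k → k < 2 → cyclePart k ≈ cycleProduct * 0#
  cyclePart-short k k<2 = begin
    cyclePart k                                 ≈⟨ Σ-map-cong (sublists (path 1 p)) (All.universal (λ F → reflexive (ofLength-++-cycle-short k F k<2)) _) ⟩
    Σ (map (λ _ → 0#) (sublists (path 1 p)))    ≈⟨ Σ-map-0 (sublists (path 1 p)) ⟩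
    0#                                          ≈⟨ zeroʳ _ ⟨
    cycleProduct * 0#           ∎

  cyclePart≈ : ∀ k → cyclePart k ≈ cycleProduct * σ (+ k -ℤ + 2) (map label (path 1 p))
  cyclePart≈ zero          = cyclePart-short 0 (s≤s z≤n)
  cyclePart≈ (suc zero)    = cyclePart-short 1 (s≤s (s≤s z≤n))
  cyclePart≈ (suc (suc k)) = begin
    cyclePart (suc (suc k))
      ≈⟨ Σ-map-cong (sublists (path 1 p)) (All.universal (ofLength-++-cycle k) _) ⟩
    Σ (map (λ F → cycleProduct * ofLength k π F) (sublists (path 1 p)))
      ≈⟨ Σ-map-*ˡ _ (ofLength k π) (sublists (path 1 p)) ⟩
    cycleProduct * sublistSum (ofLength k π) (path 1 p)
      ≈⟨ *-congˡ (σℕ-sublistSum label (path 1 p) k) ⟨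
    cycleProduct * σℕ k (map label (path 1 p)) ∎

  forestSum≈ : ∀ k → forestSum k ≈ σℕ k (map label H) - cycleProduct * σ (+ k -ℤ + 2) (map label (path 1 p))
  forestSum≈ k = begin
    forestSum k                                  ≈⟨ xyx⁻¹≈y (cyclePart k) (forestSum k) ⟨
    cyclePart k + forestSum k - cyclePart k      ≈⟨ +-cong (≈-sym (σℕ-H-split k)) (-‿cong (cyclePart≈ k)) ⟩
    σℕ k (map label H) - cycleProduct * σ (+ k -ℤ + 2) (map label (path 1 p)) ∎

  length-map-label-H : length (map label H) ≡ n
  length-map-label-H = trans (length-map label H) (trans (length-++-comm (path 1 p) cycle) (cong (λ m → suc (suc m)) (length-path 1 p)))

  forestSum-n≈0 : forestSum n ≈ 0#
  forestSum-n≈0 = begin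
    forestSum n
      ≈⟨ forestSum≈ n ⟩
    σℕ n (map label H) - cycleProduct * σℕ p (map label (path 1 p))
      ≈⟨ +-cong (σℕ-length (map label H) length-map-label-H)
                (-‿cong (*-congˡ (σℕ-length (map label (path 1 p)) (trans (length-map label (path 1 p)) (length-path 1 p))))) ⟩
    Π (map label H) - cycleProduct * π (path 1 p)
      ≈⟨ +-congʳ (π-++-cycle (path 1 p)) ⟩
    cycleProduct * π (path 1 p) - cycleProduct * π (path 1 p)
      ≈⟨ -‿inverseʳ _ ⟩
    0# ∎

  pathForestSum : ℕ → Carrier
  pathForestSum k = Σ (map π (forestsInOut k 1 n (path 1 (suc p))))

  pathForestSum-short : ∀ k → k < suc p → pathForestSum k ≈ 0#
  pathForestSum-short k k<1+p = reflexive (cong (λ Fs → Σ (map π Fs)) (forestsInOut-path-≢ k 1 (suc p) (<⇒≢ k<1+p)))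

  pathForestSum-full : pathForestSum (suc p) ≈ π (path 1 (suc p))
  pathForestSum-full = ≈-trans (reflexive (cong (λ Fs → Σ (map π Fs)) (forestsInOut-path-full 1 (suc p)))) (+-identityʳ _)

  coeffC-modelM : ∀ j → coeffC (modelM n) a j ≡ forestSum (n ∸ j)
  coeffC-modelM j = cong (λ E → Σ (map π (forests (n ∸ j) E))) (edgesG̃-modelM p)

  coeffD-modelM : ∀ i → coeffD (modelM n) a i ≡ pathForestSum (n ∸ i ∸ 1)
  coeffD-modelM i = cong (λ E → Σ (map π (forestsInOut (n ∸ i ∸ 1) 1 n E))) (edgesG̃*-modelM p)

  labels-path : ∀ k → map label (path 1 k) ≡ map (λ i → a (suc (suc i)) (suc i)) (upTo k)
  labels-path = map-path label

  labels-H : map label H ≡ Qn a n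
  labels-H = trans (map-++ label (path 1 p) cycle) (cong (_++ map label cycle) (labels-path p))

  c₀≈0 : coeffC (modelM n) a 0 ≈ 0#
  c₀≈0 = begin
    coeffC (modelM n) a 0  ≡⟨ coeffC-modelM 0 ⟩
    forestSum n            ≈⟨ forestSum-n≈0 ⟩
    0#                     ∎

  dᵢ≈0 : ∀ i → 1 ≤ i → coeffD (modelM n) a i ≈ 0#
  dᵢ≈0 (suc i) _ = begin
    coeffD (modelM n) a (suc i)     ≡⟨ coeffD-modelM (suc i) ⟩
    pathForestSum (suc p ∸ i ∸ 1)   ≈⟨ pathForestSum-short _ (s≤s (∸-monoˡ-≤ 1 (m∸n≤m (suc p) i))) ⟩
    0#                              ∎

  cⱼ≈σ : ∀ j → coeffC (modelM n) a j ≈ σ (+ (n ∸ j)) (Qn a n) - (a n (n ∸ 1) * a (n ∸ 1) n) * σ (+ (n ∸ j) -ℤ + 2) (Qrest a n)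
  cⱼ≈σ j = begin
    coeffC (modelM n) a j
      ≡⟨ coeffC-modelM j ⟩
    forestSum (n ∸ j)
      ≈⟨ forestSum≈ (n ∸ j) ⟩
    σℕ (n ∸ j) (map label H) - cycleProduct * σ (+ (n ∸ j) -ℤ + 2) (map label (path 1 p))
      ≡⟨ cong₂ (λ Q Q′ → σℕ (n ∸ j) Q - cycleProduct * σ (+ (n ∸ j) -ℤ + 2) Q′) labels-H (labels-path p) ⟩
    σ (+ (n ∸ j)) (Qn a n) - (a n (n ∸ 1) * a (n ∸ 1) n) * σ (+ (n ∸ j) -ℤ + 2) (Qrest a n) ∎

  d₀≈Π : coeffD (modelM n) a 0 ≈ Π (pathLabels a n)
  d₀≈Π = begin
    coeffD (modelM n) a 0       ≡⟨ coeffD-modelM 0 ⟩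
    pathForestSum (suc p)       ≈⟨ pathForestSum-full ⟩
    π (path 1 (suc p))          ≡⟨ cong Π (labels-path (suc p)) ⟩
    Π (pathLabels a n)          ∎

proposition3p3 : {c ℓ : Level} (R : CommutativeRing c ℓ) →
    let open CommutativeRing R
        open Coeffs R
    in (a : ℕ → ℕ → Carrier) (n : ℕ) → 2 ≤ n →
       (coeffC (modelM n) a 0 ≈ 0#)
       × ((i : ℕ) → 1 ≤ i → i ≤ n ∸ 1 → coeffD (modelM n) a i ≈ 0#)
       × ((j : ℕ) → 1 ≤ j → j ≤ n ∸ 1 →
            coeffC (modelM n) a j
              ≈ σ (+ (n ∸ j)) (Qn a n)
                - (a n (n ∸ 1) * a (n ∸ 1) n) * σ (+ (n ∸ j) -ℤ + 2) (Qrest a n))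
       × (coeffD (modelM n) a 0 ≈ Π (pathLabels a n))
proposition3p3 R a (suc (suc p)) (s≤s (s≤s z≤n)) = c₀≈0 , (λ i 1≤i _ → dᵢ≈0 i 1≤i) , (λ j _ _ → cⱼ≈σ j) , d₀≈Π
  where open ModelCoefficients R a p
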